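{- For each $v\in\{651,2343,4323\}$ there exists an APS$(v,v/3,v/3)$, equivalently a ZCPS-Wh$(v+1)$.
   Context: For an abelian group $(G,+)$ of order $v\equiv 3\pmod 4$ and nonzero $\alpha,\beta\in G$, an APS$(G,\alpha,\beta)$ is a set $\mathcal S$ of $(v-3)/4$ unordered pairs $\{x,y\}$ from $G$ with $\bigcup_{\{x,y\}\in\mathcal S}\pm\{x,y\}=G\setminus\{0,\pm\alpha\}$ and $\bigcup_{\{x,y\}\in\mathcal S}\pm\{x-y,x+y\}=G\setminus\{0,\pm\beta\}$; for $G=\mathbb{Z}_v$ written APS$(v,\alpha,\beta)$. A ZCPS-Wh$(v+1)$ for $v\equiv 3\pmod 4$ is a whist tournament on player set $\mathbb{Z}_v\cup\{\infty\}$ (games $(a,b,c,d)$ with partner pairs $\{a,c\},\{b,d\}$ and opponent pairs $\{a,b\},\{c,d\},\{a,d\},\{b,c\}$, arranged in $v$ rounds of $(v+1)/4$ games, every player in every round, each player partnering every other exactly once and opposing every other exactly twice) whose rounds are obtained cyclically by adding $1$ modulo $v$ (with $\infty+1=\infty$) and whose initial round partner pairs are $\{\{x,-x\}:x\in\mathbb{Z}_v\setminus\{0\}\}\cup\{\{\infty,0\}\}$. -}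

module Defs where

open import Data.Nat using (ℕ; _+_; _∸_; _/_; _%_; NonZero)
open import Data.Nat.DivMod using (m%n<n)
open import Data.Fin using (Fin; toℕ; fromℕ<)
open import Data.List using (List; []; _∷_; concatMap; length)
open import Data.List.Membership.Propositional using (_∈_)
open import Data.Product using (Σ; _×_; _,_)
open import Relation.Binary.PropositionalEquality using (_≡_; _≢_)
open import Function.Bundles using (_⇔_)

module Zmod (v : ℕ) .{{_ : NonZero v}} where

  G : Set
  G = Fin v

  ι : ℕ → G
  ι m = fromℕ< (m%n<n m v)

  _⊕_ : G → G → G
  x ⊕ y = ι (toℕ x + toℕ y)

  ⊖_ : G → G
  ⊖ x = ι (v ∸ toℕ x)

  _⊝_ : G → G → G
  x ⊝ y = x ⊕ (⊖ y)

  pm : G × G → List G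
  pm (x , y) = x ∷ ⊖ x ∷ y ∷ ⊖ y ∷ []

  pmDiffSum : G × G → List G
  pmDiffSum (x , y) = pm (x ⊝ y , x ⊕ y)

  -- S is an APS(ℤ_v, α, β), for α β ∈ ℤ_v; unordered pairs {x,y} are
  -- represented by ordered pairs (x , y) (all conditions are symmetric).
  IsAPS : G → G → List (G × G) → Set
  IsAPS α β S =
      (length S ≡ (v ∸ 3) / 4)
    × (∀ z → (z ∈ concatMap pm S) ⇔ (z ≢ ι 0 × z ≢ α × z ≢ ⊖ α))
    × (∀ z → (z ∈ concatMap pmDiffSum S) ⇔ (z ≢ ι 0 × z ≢ β × z ≢ ⊖ β))

APS : (v : ℕ) .{{_ : NonZero v}} → ℕ → ℕ → Set
APS v α β = Σ (List (G × G)) (IsAPS (ι α) (ι β))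
  where open Zmod v

module Submission where

open import Defs
open import Data.Nat using (ℕ; _+_; _∸_; _/_; _%_; NonZero; _≟_)
open import Data.Nat.Properties using (≤-decTotalOrder)
open import Data.Nat.DivMod using (m%n<n)
open import Data.Fin using (toℕ)
open import Data.Fin.Properties using (toℕ-fromℕ<; toℕ-injective; toℕ<n)
open import Data.List using (List; []; _∷_; concatMap; length; map; filter; upTo)
open import Data.List.Properties using (length-map; map-concatMap; concatMap-map; concatMap-cong)
open import Data.List.Membership.Propositional using (_∈_)
open import Data.List.Membership.Propositional.Properties
  using (∈-map⁺; ∈-map⁻; ∈-filter⁺; ∈-filter⁻; ∈-upTo⁺)
open import Data.List.Relation.Binary.Permutation.Propositional using (_↭_; ↭-sym)
open import Data.List.Relation.Binary.Permutation.Propositional.Properties using (∈-resp-↭)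
open import Data.List.Sort.MergeSort ≤-decTotalOrder using (sort; mergeSort)
open import Data.List.Sort.Base using (SortingAlgorithm)
open import Data.Product using (_×_; _,_; proj₂)
open import Function using (_∘_)
open import Function.Bundles using (_⇔_; mk⇔; Equivalence)
open import Relation.Binary.PropositionalEquality using (_≡_; _≢_; refl; sym; trans; cong; cong₂; subst; module ≡-Reasoning)
open import Relation.Nullary using (Dec; ¬?)
open import Relation.Nullary.Decidable using (_×-dec_)

-- The three pair sets are verified by evaluation on representatives in
-- [0, v). Since toℕ turns the ℤ_v arithmetic into arithmetic modulo v, it
-- suffices that sorting the representatives of all ±{x,y} (resp. ±{x−y,x+y})
-- gives exactly the increasing list of residues other than 0, ±α (resp. 0, ±β):
-- membership is invariant under sorting, and toℕ is injective.

sort-↭ : ∀ xs → sort xs ↭ xs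
sort-↭ = SortingAlgorithm.sort-↭ mergeSort

module APSCertificate (v : ℕ) .{{_ : NonZero v}} where
  open Zmod v

  negℕ : ℕ → ℕ
  negℕ a = (v ∸ a) % v

  addℕ : ℕ → ℕ → ℕ
  addℕ a b = (a + b) % v

  pmℕ : ℕ × ℕ → List ℕ
  pmℕ (a , b) = a ∷ negℕ a ∷ b ∷ negℕ b ∷ []

  pmDiffSumℕ : ℕ × ℕ → List ℕ
  pmDiffSumℕ (a , b) = pmℕ (addℕ a (negℕ b) , addℕ a b)

  reduce : ℕ × ℕ → ℕ × ℕ
  reduce (a , b) = a % v , b % v

  ι² : ℕ × ℕ → G × G
  ι² (a , b) = ι a , ι b

  toℕ-ι : ∀ m → toℕ (ι m) ≡ m % v
  toℕ-ι m = toℕ-fromℕ< (m%n<n m v)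

  toℕ-⊖ : ∀ x → toℕ (⊖ x) ≡ negℕ (toℕ x)
  toℕ-⊖ x = toℕ-ι (v ∸ toℕ x)

  toℕ-⊕ : ∀ x y → toℕ (x ⊕ y) ≡ addℕ (toℕ x) (toℕ y)
  toℕ-⊕ x y = toℕ-ι (toℕ x + toℕ y)

  map-toℕ-pm : ∀ x y → map toℕ (pm (x , y)) ≡ pmℕ (toℕ x , toℕ y)
  map-toℕ-pm x y rewrite toℕ-⊖ x | toℕ-⊖ y = refl

  map-toℕ-pmDiffSum : ∀ x y → map toℕ (pmDiffSum (x , y)) ≡ pmDiffSumℕ (toℕ x , toℕ y)
  map-toℕ-pmDiffSum x y
    rewrite map-toℕ-pm (x ⊝ y) (x ⊕ y) | toℕ-⊕ x (⊖ y) | toℕ-⊖ y | toℕ-⊕ x y = refl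

  map-toℕ-concatMap-ι² : (f : G × G → List G) (g : ℕ × ℕ → List ℕ) →
    (∀ x y → map toℕ (f (x , y)) ≡ g (toℕ x , toℕ y)) →
    ∀ S → map toℕ (concatMap f (map ι² S)) ≡ concatMap g (map reduce S)
  map-toℕ-concatMap-ι² f g f≈g S = begin
    map toℕ (concatMap f (map ι² S))       ≡⟨ map-concatMap toℕ f (map ι² S) ⟩
    concatMap (map toℕ ∘ f) (map ι² S)     ≡⟨ concatMap-map (map toℕ ∘ f) ι² S ⟩
    concatMap (map toℕ ∘ f ∘ ι²) S         ≡⟨ concatMap-cong f∘ι²≈g∘reduce S ⟩
    concatMap (g ∘ reduce) S               ≡⟨ concatMap-map g reduce S ⟨
    concatMap g (map reduce S)             ∎
    where
    open ≡-Reasoning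
    f∘ι²≈g∘reduce : ∀ p → map toℕ (f (ι² p)) ≡ g (reduce p)
    f∘ι²≈g∘reduce (a , b) = trans (f≈g (ι a) (ι b)) (cong₂ (λ x y → g (x , y)) (toℕ-ι a) (toℕ-ι b))

  Admissible : ℕ → ℕ → Set
  Admissible c k = k ≢ 0 % v × k ≢ c × k ≢ negℕ c

  admissible? : ∀ c k → Dec (Admissible c k)
  admissible? c k = ¬? (k ≟ 0 % v) ×-dec ¬? (k ≟ c) ×-dec ¬? (k ≟ negℕ c)

  admissibleResidues : ℕ → List ℕ
  admissibleResidues c = filter (admissible? c) (upTo v)

  toℕ-admissible⇔ : ∀ c z →
    Admissible (c % v) (toℕ z) ⇔ (z ≢ ι 0 × z ≢ ι c × z ≢ ⊖ (ι c))
  toℕ-admissible⇔ c z = mk⇔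
    (λ (z≢0 , z≢c , z≢-c) →
      (z≢0 ∘ via (toℕ-ι 0)) , (z≢c ∘ via (toℕ-ι c)) , (z≢-c ∘ via toℕ-⊖ι))
    (λ (z≢0 , z≢c , z≢-c) →
      (z≢0 ∘ back (toℕ-ι 0)) , (z≢c ∘ back (toℕ-ι c)) , (z≢-c ∘ back toℕ-⊖ι))
    where
    toℕ-⊖ι : toℕ (⊖ (ι c)) ≡ negℕ (c % v)
    toℕ-⊖ι = trans (toℕ-⊖ (ι c)) (cong negℕ (toℕ-ι c))
    via : ∀ {y k} → toℕ y ≡ k → z ≡ y → toℕ z ≡ k
    via toℕy≡k z≡y = trans (cong toℕ z≡y) toℕy≡k
    back : ∀ {y k} → toℕ y ≡ k → toℕ z ≡ k → z ≡ y
    back toℕy≡k toℕz≡k = toℕ-injective (trans toℕz≡k (sym toℕy≡k))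

  ∈-admissibleResidues⇔ : ∀ c z →
    toℕ z ∈ admissibleResidues (c % v) ⇔ (z ≢ ι 0 × z ≢ ι c × z ≢ ⊖ (ι c))
  ∈-admissibleResidues⇔ c z = mk⇔
    (Equivalence.to (toℕ-admissible⇔ c z) ∘ proj₂ ∘ ∈-filter⁻ (admissible? (c % v)) {xs = upTo v})
    (∈-filter⁺ (admissible? (c % v)) (∈-upTo⁺ (toℕ<n z)) ∘ Equivalence.from (toℕ-admissible⇔ c z))

  ∈⇔≢0,±c : ∀ (L : List G) c → sort (map toℕ L) ≡ admissibleResidues (c % v) →
    ∀ z → z ∈ L ⇔ (z ≢ ι 0 × z ≢ ι c × z ≢ ⊖ (ι c))
  ∈⇔≢0,±c L c sorted≡ z = mk⇔
    (Equivalence.to (∈-admissibleResidues⇔ c z) ∘ toAdmissible ∘ ∈-map⁺ toℕ)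
    (fromToℕ ∘ fromAdmissible ∘ Equivalence.from (∈-admissibleResidues⇔ c z))
    where
    toAdmissible : ∀ {k} → k ∈ map toℕ L → k ∈ admissibleResidues (c % v)
    toAdmissible = subst (_ ∈_) sorted≡ ∘ ∈-resp-↭ (↭-sym (sort-↭ (map toℕ L)))
    fromAdmissible : ∀ {k} → k ∈ admissibleResidues (c % v) → k ∈ map toℕ L
    fromAdmissible = ∈-resp-↭ (sort-↭ (map toℕ L)) ∘ subst (_ ∈_) (sym sorted≡)
    fromToℕ : toℕ z ∈ map toℕ L → z ∈ L
    fromToℕ toℕz∈ with x , x∈L , toℕz≡toℕx ← ∈-map⁻ toℕ toℕz∈ =
      subst (_∈ L) (sym (toℕ-injective toℕz≡toℕx)) x∈L

  aps-fromCertificate : ∀ α β (S : List (ℕ × ℕ)) → length S ≡ (v ∸ 3) / 4 →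
    sort (concatMap pmℕ (map reduce S)) ≡ admissibleResidues (α % v) →
    sort (concatMap pmDiffSumℕ (map reduce S)) ≡ admissibleResidues (β % v) →
    APS v α β
  aps-fromCertificate α β S length≡ pm-sorted≡ pmDiffSum-sorted≡ =
    map ι² S ,
    trans (length-map ι² S) length≡ ,
    ∈⇔≢0,±c _ α (reflect pm pmℕ map-toℕ-pm pm-sorted≡) ,
    ∈⇔≢0,±c _ β (reflect pmDiffSum pmDiffSumℕ map-toℕ-pmDiffSum pmDiffSum-sorted≡)
    where
    reflect : (f : G × G → List G) (g : ℕ × ℕ → List ℕ) →
      (∀ x y → map toℕ (f (x , y)) ≡ g (toℕ x , toℕ y)) → ∀ {R} →
      sort (concatMap g (map reduce S)) ≡ R → sort (map toℕ (concatMap f (map ι² S))) ≡ R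
    reflect f g f≈g = trans (cong sort (map-toℕ-concatMap-ι² f g f≈g S))

open APSCertificate using (aps-fromCertificate)

S651 : List (ℕ × ℕ)
S651 =
  (6 , 321) ∷ (150 , 213) ∷ (495 , 117) ∷ (17 , 245) ∷ (425 , 266) ∷ (209 , 140) ∷ (29 , 262) ∷ (74 , 40) ∷
  (548 , 349) ∷ (72 , 372) ∷ (498 , 186) ∷ (81 , 93) ∷ (3 , 62) ∷ (75 , 248) ∷ (573 , 341) ∷ (83 , 218) ∷
  (122 , 242) ∷ (446 , 191) ∷ (41 , 315) ∷ (374 , 63) ∷ (236 , 273) ∷ (71 , 472) ∷ (473 , 82) ∷ (107 , 97) ∷
  (92 , 397) ∷ (347 , 160) ∷ (212 , 94) ∷ (22 , 600) ∷ (550 , 27) ∷ (79 , 24) ∷ (43 , 292) ∷ (424 , 139) ∷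
  (184 , 220) ∷ (89 , 164) ∷ (272 , 194) ∷ (290 , 293) ∷ (19 , 32) ∷ (475 , 149) ∷ (157 , 470) ∷ (14 , 393) ∷
  (350 , 60) ∷ (287 , 198) ∷ (15 , 56) ∷ (375 , 98) ∷ (261 , 497) ∷ (44 , 264) ∷ (449 , 90) ∷ (158 , 297) ∷
  (36 , 474) ∷ (249 , 132) ∷ (366 , 45) ∷ (9 , 167) ∷ (225 , 269) ∷ (417 , 215) ∷ (31 , 298) ∷ (124 , 289) ∷
  (496 , 64) ∷ (46 , 394) ∷ (499 , 85) ∷ (106 , 172) ∷ (1 , 447) ∷ (25 , 108) ∷ (625 , 96) ∷ (21 , 116) ∷
  (525 , 296) ∷ (105 , 239) ∷ (30 , 420) ∷ (99 , 84) ∷ (522 , 147) ∷ (8 , 13) ∷ (200 , 325) ∷ (443 , 313) ∷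
  (2 , 18) ∷ (50 , 450) ∷ (599 , 183) ∷ (114 , 268) ∷ (246 , 190) ∷ (291 , 193) ∷ (137 , 216) ∷ (170 , 192) ∷
  (344 , 243) ∷ (39 , 48) ∷ (324 , 549) ∷ (288 , 54) ∷ (28 , 196) ∷ (49 , 343) ∷ (574 , 112) ∷ (35 , 244) ∷
  (224 , 241) ∷ (392 , 166) ∷ (10 , 146) ∷ (250 , 395) ∷ (391 , 110) ∷ (20 , 133) ∷ (500 , 70) ∷ (131 , 448) ∷
  (11 , 12) ∷ (275 , 300) ∷ (365 , 339) ∷ (136 , 318) ∷ (145 , 138) ∷ (370 , 195) ∷ (86 , 294) ∷ (197 , 189) ∷
  (368 , 168) ∷ (55 , 135) ∷ (73 , 120) ∷ (523 , 396) ∷ (59 , 121) ∷ (173 , 421) ∷ (419 , 109) ∷ (65 , 119) ∷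
  (323 , 371) ∷ (263 , 161) ∷ (38 , 66) ∷ (299 , 348) ∷ (314 , 237) ∷ (57 , 95) ∷ (123 , 422) ∷ (471 , 134) ∷
  (34 , 320) ∷ (199 , 188) ∷ (418 , 143) ∷ (68 , 423) ∷ (398 , 159) ∷ (185 , 69) ∷ (91 , 240) ∷ (322 , 141) ∷
  (238 , 270) ∷ (58 , 187) ∷ (148 , 118) ∷ (445 , 346) ∷ (47 , 211) ∷ (524 , 67) ∷ (80 , 373) ∷ (42 , 214) ∷
  (399 , 142) ∷ (210 , 295) ∷ (23 , 115) ∷ (575 , 271) ∷ (53 , 265) ∷ (7 , 223) ∷ (175 , 367) ∷ (469 , 61) ∷
  (4 , 165) ∷ (100 , 219) ∷ (547 , 267) ∷ (37 , 87) ∷ (274 , 222) ∷ (340 , 342) ∷ (33 , 144) ∷ (174 , 345) ∷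
  (444 , 162) ∷ (111 , 317) ∷ (171 , 113) ∷ (369 , 221) ∷ (5 , 247) ∷ (125 , 316) ∷ (521 , 88) ∷ (16 , 163) ∷
  (400 , 169) ∷ (235 , 319) ∷ []

S2343 : List (ℕ × ℕ)
S2343 =
  (7 , 1939) ∷ (175 , 1615) ∷ (2032 , 544) ∷ (1597 , 1885) ∷ (94 , 265) ∷ (69 , 1880) ∷ (1725 , 140) ∷ (951 , 1157) ∷
  (345 , 809) ∷ (1596 , 1481) ∷ (110 , 771) ∷ (407 , 531) ∷ (803 , 1560) ∷ (1331 , 1512) ∷ (473 , 312) ∷ (215 , 699) ∷
  (689 , 1074) ∷ (824 , 1077) ∷ (1856 , 1152) ∷ (1883 , 684) ∷ (83 , 630) ∷ (2075 , 1692) ∷ (329 , 126) ∷ (1196 , 807) ∷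
  (1784 , 1431) ∷ (203 , 1926) ∷ (389 , 1290) ∷ (353 , 1791) ∷ (1796 , 258) ∷ (383 , 1764) ∷ (38 , 578) ∷ (950 , 392) ∷
  (320 , 428) ∷ (971 , 1328) ∷ (845 , 398) ∷ (31 , 1802) ∷ (775 , 533) ∷ (631 , 1610) ∷ (1717 , 419) ∷ (751 , 1103) ∷
  (46 , 509) ∷ (1150 , 1010) ∷ (634 , 1820) ∷ (1792 , 983) ∷ (283 , 1145) ∷ (22 , 896) ∷ (550 , 1313) ∷ (2035 , 23) ∷
  (1672 , 575) ∷ (1969 , 317) ∷ (41 , 1899) ∷ (1025 , 615) ∷ (2195 , 1317) ∷ (986 , 123) ∷ (1220 , 732) ∷ (54 , 1298) ∷
  (1350 , 1991) ∷ (948 , 572) ∷ (270 , 242) ∷ (2064 , 1364) ∷ (44 , 173) ∷ (1100 , 1982) ∷ (1727 , 347) ∷ (1001 , 1646) ∷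
  (1595 , 1319) ∷ (53 , 56) ∷ (1325 , 1400) ∷ (323 , 2198) ∷ (1046 , 1061) ∷ (377 , 752) ∷ (137 , 1348) ∷ (1082 , 898) ∷
  (1277 , 1363) ∷ (1466 , 1273) ∷ (1505 , 1366) ∷ (1 , 2041) ∷ (25 , 1822) ∷ (625 , 1033) ∷ (1567 , 52) ∷ (1687 , 1300) ∷
  (37 , 1585) ∷ (925 , 2137) ∷ (2038 , 1879) ∷ (1747 , 115) ∷ (1501 , 532) ∷ (134 , 1009) ∷ (1007 , 1795) ∷ (1745 , 358) ∷
  (1451 , 1921) ∷ (1130 , 1165) ∷ (3 , 797) ∷ (75 , 1181) ∷ (1875 , 1409) ∷ (15 , 80) ∷ (375 , 2000) ∷ (61 , 360) ∷
  (1525 , 1971) ∷ (637 , 72) ∷ (1867 , 1800) ∷ (2158 , 483) ∷ (122 , 204) ∷ (707 , 414) ∷ (1274 , 978) ∷ (1391 , 1020) ∷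
  (1973 , 2070) ∷ (66 , 478) ∷ (1650 , 235) ∷ (1419 , 1189) ∷ (330 , 1609) ∷ (1221 , 394) ∷ (81 , 520) ∷ (2025 , 1285) ∷
  (1422 , 1666) ∷ (405 , 1819) ∷ (753 , 958) ∷ (113 , 614) ∷ (482 , 1292) ∷ (335 , 1841) ∷ (1346 , 1508) ∷ (848 , 212) ∷
  (2 , 1664) ∷ (50 , 1769) ∷ (1250 , 2051) ∷ (791 , 2072) ∷ (1031 , 254) ∷ (62 , 1695) ∷ (1550 , 201) ∷ (1262 , 339) ∷
  (1091 , 1446) ∷ (1502 , 1005) ∷ (34 , 1183) ∷ (850 , 1459) ∷ (163 , 1330) ∷ (1732 , 448) ∷ (1126 , 1828) ∷ (5 , 565) ∷
  (125 , 67) ∷ (782 , 1675) ∷ (806 , 2044) ∷ (1406 , 1897) ∷ (39 , 2182) ∷ (975 , 661) ∷ (945 , 124) ∷ (195 , 757) ∷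
  (189 , 181) ∷ (13 , 1421) ∷ (325 , 380) ∷ (1096 , 128) ∷ (1627 , 857) ∷ (844 , 338) ∷ (141 , 676) ∷ (1182 , 499) ∷
  (1434 , 760) ∷ (705 , 256) ∷ (1224 , 1714) ∷ (171 , 1754) ∷ (1932 , 1676) ∷ (1440 , 2069) ∷ (855 , 179) ∷ (288 , 2132) ∷
  (99 , 1588) ∷ (132 , 2212) ∷ (957 , 1411) ∷ (495 , 130) ∷ (660 , 907) ∷ (313 , 691) ∷ (796 , 874) ∷ (1156 , 763) ∷
  (784 , 331) ∷ (856 , 1246) ∷ (70 , 1140) ∷ (1750 , 384) ∷ (1576 , 228) ∷ (1912 , 1014) ∷ (940 , 1920) ∷ (10 , 756) ∷
  (250 , 156) ∷ (1564 , 1557) ∷ (1612 , 1437) ∷ (469 , 780) ∷ (155 , 962) ∷ (1532 , 620) ∷ (812 , 1442) ∷ (1556 , 905) ∷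
  (1412 , 1538) ∷ (8 , 827) ∷ (200 , 1931) ∷ (314 , 1415) ∷ (821 , 230) ∷ (1781 , 1064) ∷ (149 , 969) ∷ (1382 , 795) ∷
  (1748 , 1131) ∷ (1526 , 159) ∷ (662 , 1632) ∷ (410 , 1817) ∷ (878 , 908) ∷ (863 , 1613) ∷ (488 , 494) ∷ (485 , 635) ∷
  (102 , 1370) ∷ (207 , 1448) ∷ (489 , 1055) ∷ (510 , 602) ∷ (1035 , 992) ∷ (19 , 659) ∷ (475 , 74) ∷ (160 , 1850) ∷
  (1657 , 1733) ∷ (1594 , 1151) ∷ (197 , 219) ∷ (239 , 789) ∷ (1289 , 981) ∷ (1766 , 1095) ∷ (1976 , 1602) ∷ (220 , 1515) ∷
  (814 , 387) ∷ (1606 , 303) ∷ (319 , 546) ∷ (946 , 1935) ∷ (260 , 902) ∷ (1814 , 1463) ∷ (833 , 1430) ∷ (2081 , 605) ∷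
  (479 , 1067) ∷ (253 , 1367) ∷ (1639 , 1373) ∷ (1144 , 1523) ∷ (484 , 587) ∷ (385 , 617) ∷ (32 , 1467) ∷ (800 , 1530) ∷
  (1256 , 762) ∷ (941 , 306) ∷ (95 , 621) ∷ (226 , 512) ∷ (964 , 1085) ∷ (670 , 1352) ∷ (349 , 998) ∷ (1696 , 1520) ∷
  (68 , 1080) ∷ (1700 , 1227) ∷ (326 , 216) ∷ (1121 , 714) ∷ (2252 , 1449) ∷ (27 , 1426) ∷ (675 , 505) ∷ (474 , 910) ∷
  (135 , 1663) ∷ (1032 , 1744) ∷ (202 , 985) ∷ (364 , 1195) ∷ (2071 , 1759) ∷ (229 , 1801) ∷ (1039 , 508) ∷ (170 , 1003) ∷
  (1907 , 1645) ∷ (815 , 1294) ∷ (1631 , 1891) ∷ (944 , 415) ∷ (18 , 1798) ∷ (450 , 433) ∷ (1878 , 1453) ∷ (90 , 1180) ∷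
  (2250 , 1384) ∷ (227 , 1630) ∷ (989 , 919) ∷ (1295 , 1888) ∷ (1916 , 340) ∷ (1040 , 1471) ∷ (20 , 1052) ∷ (500 , 527) ∷
  (785 , 1460) ∷ (881 , 1355) ∷ (938 , 1073) ∷ (98 , 445) ∷ (107 , 1753) ∷ (332 , 1651) ∷ (1271 , 1444) ∷ (1316 , 955) ∷
  (14 , 1320) ∷ (350 , 198) ∷ (1721 , 264) ∷ (851 , 1914) ∷ (188 , 990) ∷ (28 , 1942) ∷ (700 , 1690) ∷ (1099 , 76) ∷
  (1702 , 1900) ∷ (376 , 640) ∷ (245 , 1605) ∷ (1439 , 294) ∷ (830 , 321) ∷ (2006 , 996) ∷ (947 , 1470) ∷ (57 , 794) ∷
  (1425 , 1106) ∷ (480 , 1877) ∷ (285 , 65) ∷ (96 , 1625) ∷ (33 , 2150) ∷ (825 , 2204) ∷ (1881 , 1211) ∷ (165 , 2159) ∷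
  (1782 , 86) ∷ (55 , 167) ∷ (1375 , 1832) ∷ (1573 , 1283) ∷ (1837 , 1616) ∷ (1408 , 569) ∷ (106 , 1369) ∷ (307 , 1423) ∷
  (646 , 430) ∷ (2092 , 1378) ∷ (754 , 1648) ∷ (147 , 706) ∷ (1332 , 1249) ∷ (498 , 766) ∷ (735 , 406) ∷ (1974 , 778) ∷
  (16 , 21) ∷ (400 , 525) ∷ (628 , 1410) ∷ (1642 , 105) ∷ (1219 , 282) ∷ (40 , 103) ∷ (1000 , 232) ∷ (1570 , 1114) ∷
  (1762 , 2077) ∷ (1876 , 379) ∷ (111 , 1628) ∷ (432 , 869) ∷ (1428 , 638) ∷ (555 , 1892) ∷ (2160 , 440) ∷ (17 , 956) ∷
  (425 , 470) ∷ (1253 , 35) ∷ (866 , 875) ∷ (563 , 788) ∷ (138 , 1231) ∷ (1107 , 316) ∷ (1902 , 871) ∷ (690 , 688) ∷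
  (849 , 799) ∷ (58 , 949) ∷ (1450 , 295) ∷ (1105 , 346) ∷ (1852 , 1621) ∷ (1783 , 694) ∷ (78 , 362) ∷ (1950 , 2021) ∷
  (1890 , 1322) ∷ (390 , 248) ∷ (378 , 1514) ∷ (164 , 769) ∷ (1757 , 481) ∷ (1751 , 310) ∷ (1601 , 721) ∷ (194 , 1624) ∷
  (77 , 984) ∷ (1925 , 1170) ∷ (1265 , 1134) ∷ (1166 , 234) ∷ (1034 , 1164) ∷ (71 , 199) ∷ (1775 , 289) ∷ (2201 , 196) ∷
  (1136 , 214) ∷ (284 , 664) ∷ (12 , 2080) ∷ (300 , 454) ∷ (471 , 1978) ∷ (60 , 247) ∷ (1500 , 1489) ∷ (82 , 585) ∷
  (2050 , 567) ∷ (2047 , 117) ∷ (1972 , 582) ∷ (97 , 492) ∷ (64 , 403) ∷ (1600 , 703) ∷ (169 , 1174) ∷ (1882 , 1234) ∷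
  (190 , 391) ∷ (116 , 810) ∷ (557 , 1506) ∷ (2210 , 162) ∷ (1361 , 1707) ∷ (1223 , 501) ∷ (152 , 514) ∷ (1457 , 1135) ∷
  (1280 , 259) ∷ (1541 , 1789) ∷ (1037 , 208) ∷ (223 , 1517) ∷ (889 , 437) ∷ (1138 , 1553) ∷ (334 , 1337) ∷ (1321 , 623) ∷
  (205 , 395) ∷ (439 , 503) ∷ (1603 , 860) ∷ (244 , 413) ∷ (1414 , 953) ∷ (101 , 1139) ∷ (182 , 359) ∷ (2207 , 1946) ∷
  (1286 , 1790) ∷ (1691 , 233) ∷ (26 , 59) ∷ (650 , 1475) ∷ (2192 , 1730) ∷ (911 , 1076) ∷ (1688 , 1127) ∷ (224 , 1545) ∷
  (914 , 1137) ∷ (1763 , 309) ∷ (1901 , 696) ∷ (665 , 999) ∷ (29 , 301) ∷ (725 , 496) ∷ (1724 , 685) ∷ (926 , 724) ∷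
  (2063 , 1699) ∷ (42 , 104) ∷ (1050 , 257) ∷ (477 , 1739) ∷ (210 , 1301) ∷ (564 , 2066) ∷ (11 , 639) ∷ (275 , 1917) ∷
  (2189 , 1065) ∷ (836 , 852) ∷ (2156 , 213) ∷ (119 , 1535) ∷ (632 , 887) ∷ (1742 , 1088) ∷ (1376 , 1427) ∷ (1598 , 530) ∷
  (209 , 1853) ∷ (539 , 1808) ∷ (1760 , 683) ∷ (1826 , 674) ∷ (1133 , 449) ∷ (43 , 1129) ∷ (1075 , 109) ∷ (1102 , 382) ∷
  (1777 , 178) ∷ (2251 , 2107) ∷ (49 , 682) ∷ (1225 , 649) ∷ (166 , 2167) ∷ (1807 , 286) ∷ (658 , 121) ∷ (324 , 1142) ∷
  (1071 , 434) ∷ (1002 , 1478) ∷ (1620 , 1805) ∷ (669 , 608) ∷ (88 , 663) ∷ (2200 , 174) ∷ (1111 , 2007) ∷ (2002 , 972) ∷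
  (847 , 870) ∷ (241 , 792) ∷ (1339 , 1056) ∷ (673 , 627) ∷ (424 , 1617) ∷ (1228 , 594) ∷ (4 , 1970) ∷ (100 , 47) ∷
  (157 , 1175) ∷ (1582 , 1259) ∷ (2062 , 1016) ∷ (63 , 994) ∷ (1575 , 1420) ∷ (1887 , 355) ∷ (315 , 1846) ∷ (846 , 1633) ∷
  (36 , 1987) ∷ (900 , 472) ∷ (1413 , 85) ∷ (180 , 2125) ∷ (2157 , 1579) ∷ (73 , 409) ∷ (1825 , 853) ∷ (1108 , 238) ∷
  (1927 , 1264) ∷ (1315 , 1141) ∷ (127 , 217) ∷ (832 , 739) ∷ (2056 , 2074) ∷ (2197 , 304) ∷ (1036 , 571) ∷ (6 , 1324) ∷
  (150 , 298) ∷ (1407 , 421) ∷ (30 , 1153) ∷ (750 , 709) ∷ (51 , 859) ∷ (1275 , 388) ∷ (1416 , 328) ∷ (255 , 1171) ∷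
  (1689 , 1159) ∷ (89 , 1740) ∷ (2225 , 1326) ∷ (1736 , 348) ∷ (1226 , 1671) ∷ (191 , 1944) ∷ (79 , 158) ∷ (1975 , 1607) ∷
  (172 , 344) ∷ (1957 , 1571) ∷ (2065 , 1787) ∷ (24 , 2122) ∷ (600 , 1504) ∷ (942 , 112) ∷ (120 , 457) ∷ (657 , 2053) ∷
  (84 , 222) ∷ (2100 , 864) ∷ (954 , 513) ∷ (420 , 1110) ∷ (1128 , 1977) ∷ (249 , 1542) ∷ (1539 , 1062) ∷ (987 , 777) ∷
  (1245 , 681) ∷ (666 , 624) ∷ (246 , 327) ∷ (1464 , 1146) ∷ (1455 , 534) ∷ (1230 , 1635) ∷ (291 , 1044) ∷ (87 , 702) ∷
  (2175 , 1149) ∷ (486 , 609) ∷ (435 , 1167) ∷ (1503 , 1059) ∷ (237 , 528) ∷ (1239 , 1485) ∷ (516 , 1980) ∷ (1185 , 297) ∷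
  (1509 , 396) ∷ (9 , 717) ∷ (225 , 1524) ∷ (939 , 612) ∷ (45 , 1242) ∷ (1125 , 591) ∷ (108 , 144) ∷ (357 , 1257) ∷
  (1896 , 966) ∷ (540 , 720) ∷ (1785 , 1599) ∷ (129 , 885) ∷ (882 , 1038) ∷ (963 , 177) ∷ (645 , 2082) ∷ (2067 , 504) ∷
  (231 , 1296) ∷ (1089 , 1941) ∷ (1452 , 1665) ∷ (1155 , 1794) ∷ (759 , 333) ∷ (267 , 351) ∷ (1989 , 1746) ∷ (522 , 1476) ∷
  (1335 , 1755) ∷ (573 , 1701) ∷ (153 , 342) ∷ (1482 , 1521) ∷ (1905 , 537) ∷ (765 , 1710) ∷ (381 , 576) ∷ (114 , 1092) ∷
  (507 , 1527) ∷ (960 , 687) ∷ (570 , 774) ∷ (192 , 606) ∷ (48 , 519) ∷ (1200 , 1260) ∷ (1884 , 1041) ∷ (240 , 252) ∷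
  (1314 , 1614) ∷ []

S4323 : List (ℕ × ℕ)
S4323 =
  (132 , 492) ∷ (3333 , 2598) ∷ (3102 , 3702) ∷ (2673 , 2889) ∷ (3729 , 3288) ∷ (111 , 3561) ∷ (2115 , 3357) ∷ (1626 , 171) ∷
  (3525 , 1272) ∷ (1269 , 285) ∷ (432 , 2661) ∷ (3441 , 3033) ∷ (720 , 2994) ∷ (2853 , 732) ∷ (1200 , 3549) ∷ (78 , 3736) ∷
  (201 , 538) ∷ (3012 , 943) ∷ (1776 , 2818) ∷ (3579 , 3493) ∷ (567 , 633) ∷ (2625 , 2130) ∷ (945 , 2496) ∷ (2934 , 2109) ∷
  (1575 , 1278) ∷ (38 , 1763) ∷ (2204 , 2825) ∷ (2465 , 3899) ∷ (311 , 1346) ∷ (746 , 254) ∷ (332 , 850) ∷ (1964 , 1747) ∷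
  (1514 , 1897) ∷ (1352 , 1951) ∷ (602 , 760) ∷ (65 , 200) ∷ (3770 , 2954) ∷ (2510 , 2735) ∷ (2921 , 3002) ∷ (821 , 1196) ∷
  (19 , 381) ∷ (1102 , 483) ∷ (3394 , 2076) ∷ (2317 , 3687) ∷ (373 , 2019) ∷ (181 , 3305) ∷ (1852 , 1478) ∷ (3664 , 3587) ∷
  (685 , 542) ∷ (823 , 1175) ∷ (107 , 686) ∷ (1883 , 881) ∷ (1139 , 3545) ∷ (1217 , 2429) ∷ (1418 , 2546) ∷ (39 , 339) ∷
  (2262 , 2370) ∷ (1506 , 3447) ∷ (888 , 1068) ∷ (3951 , 1422) ∷ (40 , 1226) ∷ (2320 , 1940) ∷ (547 , 122) ∷ (1465 , 2753) ∷
  (2833 , 4046) ∷ (250 , 2737) ∷ (1531 , 3118) ∷ (2338 , 3601) ∷ (1591 , 1354) ∷ (1495 , 718) ∷ (341 , 3325) ∷ (2486 , 2638) ∷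
  (1529 , 1699) ∷ (2222 , 3436) ∷ (3509 , 430) ∷ (61 , 1607) ∷ (3538 , 2423) ∷ (2023 , 2198) ∷ (613 , 2117) ∷ (970 , 1742) ∷
  (126 , 3619) ∷ (2985 , 2398) ∷ (210 , 748) ∷ (3534 , 154) ∷ (1791 , 286) ∷ (10 , 224) ∷ (580 , 23) ∷ (3379 , 1334) ∷
  (1447 , 3881) ∷ (1789 , 302) ∷ (28 , 4060) ∷ (1624 , 2038) ∷ (3409 , 1483) ∷ (3187 , 3877) ∷ (3280 , 70) ∷ (164 , 1739) ∷
  (866 , 1433) ∷ (2675 , 977) ∷ (3845 , 467) ∷ (2537 , 1148) ∷ (316 , 1720) ∷ (1036 , 331) ∷ (3889 , 1906) ∷ (766 , 2473) ∷
  (1198 , 775) ∷ (189 , 3093) ∷ (2316 , 2151) ∷ (315 , 3714) ∷ (978 , 3585) ∷ (525 , 426) ∷ (350 , 3104) ∷ (3008 , 2789) ∷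
  (1544 , 1811) ∷ (3092 , 1286) ∷ (2093 , 1097) ∷ (1232 , 2342) ∷ (2288 , 1823) ∷ (3014 , 1982) ∷ (1892 , 2558) ∷ (1661 , 1382) ∷
  (68 , 2612) ∷ (3944 , 191) ∷ (3956 , 2432) ∷ (329 , 2720) ∷ (1790 , 2132) ∷ (157 , 3299) ∷ (460 , 1130) ∷ (742 , 695) ∷
  (4129 , 1403) ∷ (1717 , 3560) ∷ (271 , 620) ∷ (2749 , 1376) ∷ (3814 , 1994) ∷ (739 , 3254) ∷ (3955 , 2843) ∷ (55 , 1066) ∷
  (3190 , 1306) ∷ (3454 , 2257) ∷ (1474 , 1216) ∷ (3355 , 1360) ∷ (48 , 2253) ∷ (2784 , 984) ∷ (1521 , 873) ∷ (1758 , 3081) ∷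
  (2535 , 1455) ∷ (237 , 2694) ∷ (777 , 624) ∷ (1836 , 1608) ∷ (2736 , 2481) ∷ (3060 , 1239) ∷ (121 , 910) ∷ (2695 , 904) ∷
  (682 , 556) ∷ (649 , 1987) ∷ (3058 , 2848) ∷ (32 , 985) ∷ (1856 , 931) ∷ (3896 , 2122) ∷ (1172 , 2032) ∷ (3131 , 1135) ∷
  (158 , 1152) ∷ (518 , 1971) ∷ (4106 , 1920) ∷ (383 , 3285) ∷ (599 , 318) ∷ (106 , 728) ∷ (1825 , 3317) ∷ (2098 , 2174) ∷
  (640 , 725) ∷ (2536 , 3143) ∷ (244 , 715) ∷ (1183 , 2563) ∷ (3769 , 1672) ∷ (2452 , 1870) ∷ (3880 , 385) ∷ (163 , 2596) ∷
  (808 , 3586) ∷ (3634 , 484) ∷ (3268 , 2134) ∷ (3655 , 2728) ∷ (328 , 716) ∷ (1732 , 2621) ∷ (1027 , 713) ∷ (3367 , 2447) ∷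
  (751 , 3590) ∷ (11 , 2693) ∷ (638 , 566) ∷ (2420 , 2567) ∷ (2024 , 1904) ∷ (671 , 2357) ∷ (3 , 3185) ∷ (174 , 3164) ∷
  (1446 , 1946) ∷ (1731 , 470) ∷ (969 , 1322) ∷ (184 , 2488) ∷ (2026 , 1645) ∷ (787 , 304) ∷ (2416 , 340) ∷ (1792 , 2428) ∷
  (79 , 1762) ∷ (259 , 2767) ∷ (2053 , 535) ∷ (2353 , 769) ∷ (2461 , 1372) ∷ (489 , 2775) ∷ (2424 , 999) ∷ (2256 , 1743) ∷
  (1158 , 1665) ∷ (2319 , 1464) ∷ (115 , 991) ∷ (2347 , 1279) ∷ (2113 , 691) ∷ (1510 , 1171) ∷ (1120 , 3073) ∷ (6 , 2118) ∷
  (348 , 1800) ∷ (2892 , 648) ∷ (3462 , 3000) ∷ (1938 , 1080) ∷ (88 , 1014) ∷ (781 , 2613) ∷ (2068 , 249) ∷ (3223 , 1473) ∷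
  (1045 , 3297) ∷ (280 , 482) ∷ (3271 , 2018) ∷ (3829 , 323) ∷ (1609 , 1442) ∷ (2539 , 1499) ∷ (131 , 3110) ∷ (3275 , 3137) ∷
  (4061 , 380) ∷ (2096 , 425) ∷ (524 , 3035) ∷ (655 , 1022) ∷ (3406 , 3077) ∷ (3013 , 1223) ∷ (1834 , 1766) ∷ (2620 , 2999) ∷
  (418 , 3290) ∷ (2629 , 608) ∷ (1177 , 680) ∷ (3421 , 533) ∷ (3883 , 653) ∷ (167 , 3361) ∷ (1040 , 403) ∷ (4121 , 1759) ∷
  (1253 , 2593) ∷ (3506 , 3412) ∷ (76 , 108) ∷ (85 , 1941) ∷ (607 , 180) ∷ (622 , 1794) ∷ (1492 , 300) ∷ (54 , 2241) ∷
  (3132 , 288) ∷ (90 , 3735) ∷ (897 , 480) ∷ (150 , 1902) ∷ (7 , 3292) ∷ (406 , 724) ∷ (1933 , 3085) ∷ (4039 , 1687) ∷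
  (820 , 2740) ∷ (188 , 2968) ∷ (2258 , 3547) ∷ (1274 , 2545) ∷ (401 , 628) ∷ (1643 , 1840) ∷ (274 , 2260) ∷ (2923 , 1390) ∷
  (937 , 2806) ∷ (2470 , 2797) ∷ (601 , 2275) ∷ (342 , 2918) ∷ (2544 , 647) ∷ (570 , 2942) ∷ (2799 , 2039) ∷ (2391 , 1541) ∷
  (289 , 572) ∷ (3793 , 2915) ∷ (3844 , 473) ∷ (2479 , 1496) ∷ (1123 , 308) ∷ (190 , 1327) ∷ (2374 , 3475) ∷ (3679 , 2692) ∷
  (1555 , 508) ∷ (3730 , 3526) ∷ (134 , 2492) ∷ (3449 , 1877) ∷ (1184 , 791) ∷ (3827 , 2648) ∷ (1493 , 2279) ∷ (5 , 1170) ∷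
  (290 , 3015) ∷ (3851 , 1950) ∷ (2885 , 702) ∷ (3056 , 1809) ∷ (16 , 2975) ∷ (928 , 3953) ∷ (1948 , 155) ∷ (586 , 344) ∷
  (3727 , 2660) ∷ (52 , 1142) ∷ (3016 , 1391) ∷ (2008 , 2864) ∷ (4066 , 1838) ∷ (2386 , 2852) ∷ (144 , 1167) ∷ (4029 , 2841) ∷
  (240 , 504) ∷ (951 , 3294) ∷ (3282 , 840) ∷ (80 , 912) ∷ (317 , 1020) ∷ (1094 , 2961) ∷ (2930 , 3141) ∷ (1343 , 612) ∷
  (64 , 616) ∷ (3712 , 1144) ∷ (3469 , 1507) ∷ (2344 , 946) ∷ (1939 , 2992) ∷ (26 , 2434) ∷ (1508 , 2836) ∷ (1004 , 214) ∷
  (2033 , 3766) ∷ (1193 , 2278) ∷ (258 , 540) ∷ (1995 , 1059) ∷ (3312 , 900) ∷ (1884 , 324) ∷ (1197 , 1500) ∷ (133 , 3824) ∷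
  (3391 , 1319) ∷ (2143 , 3011) ∷ (3250 , 1718) ∷ (2611 , 215) ∷ (264 , 3138) ∷ (2343 , 438) ∷ (1881 , 3789) ∷ (1023 , 3612) ∷
  (3135 , 1992) ∷ (140 , 2213) ∷ (3797 , 2987) ∷ (4076 , 326) ∷ (2966 , 1616) ∷ (3431 , 2945) ∷ (35 , 578) ∷ (2030 , 3263) ∷
  (1019 , 3365) ∷ (2903 , 635) ∷ (4100 , 2246) ∷ (62 , 2207) ∷ (3596 , 2639) ∷ (1064 , 1757) ∷ (1190 , 2477) ∷ (4175 , 1007) ∷
  (346 , 3448) ∷ (2776 , 1126) ∷ (1057 , 463) ∷ (784 , 916) ∷ (2242 , 1252) ∷ (160 , 3162) ∷ (634 , 1830) ∷ (2188 , 2388) ∷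
  (1537 , 168) ∷ (2686 , 1098) ∷ (439 , 2140) ∷ (3847 , 3076) ∷ (2653 , 1165) ∷ (2569 , 2725) ∷ (2020 , 2422) ∷ (129 , 1212) ∷
  (3159 , 1128) ∷ (1656 , 579) ∷ (942 , 3321) ∷ (2760 , 2406) ∷ (233 , 907) ∷ (545 , 730) ∷ (1349 , 3433) ∷ (428 , 256) ∷
  (3209 , 1879) ∷ (417 , 1824) ∷ (2571 , 2040) ∷ (2136 , 1599) ∷ (2844 , 1959) ∷ (678 , 1224) ∷ (47 , 1061) ∷ (2726 , 1016) ∷
  (2480 , 2729) ∷ (1181 , 2654) ∷ (3653 , 2627) ∷ (173 , 2123) ∷ (1388 , 2090) ∷ (2690 , 176) ∷ (392 , 1562) ∷ (1121 , 4136) ∷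
  (8 , 2543) ∷ (464 , 512) ∷ (974 , 3758) ∷ (293 , 1814) ∷ (4025 , 1460) ∷ (41 , 2900) ∷ (2378 , 3926) ∷ (3911 , 2912) ∷
  (2042 , 299) ∷ (1715 , 50) ∷ (196 , 2021) ∷ (2722 , 497) ∷ (2248 , 2888) ∷ (694 , 3230) ∷ (1345 , 1451) ∷ (245 , 2138) ∷
  (1241 , 2960) ∷ (2810 , 3083) ∷ (3029 , 1571) ∷ (2762 , 335) ∷ (175 , 1689) ∷ (1504 , 2856) ∷ (772 , 1374) ∷ (1546 , 1878) ∷
  (3208 , 849) ∷ (63 , 1383) ∷ (3654 , 2400) ∷ (105 , 864) ∷ (1767 , 2559) ∷ (3057 , 1440) ∷ (291 , 920) ∷ (3909 , 1484) ∷
  (1926 , 3935) ∷ (3633 , 3434) ∷ (3210 , 314) ∷ (242 , 3567) ∷ (1067 , 3705) ∷ (1364 , 3063) ∷ (1298 , 411) ∷ (1793 , 2223) ∷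
  (4 , 1409) ∷ (232 , 3908) ∷ (487 , 1868) ∷ (2308 , 269) ∷ (4174 , 2633) ∷ (71 , 792) ∷ (4118 , 2706) ∷ (1079 , 1320) ∷
  (2060 , 3069) ∷ (2759 , 759) ∷ (43 , 2521) ∷ (2494 , 3559) ∷ (1993 , 3241) ∷ (3196 , 2089) ∷ (3802 , 118) ∷ (17 , 2468) ∷
  (986 , 485) ∷ (989 , 2192) ∷ (1163 , 1769) ∷ (2609 , 3173) ∷ (18 , 750) ∷ (1044 , 270) ∷ (30 , 2691) ∷ (1740 , 450) ∷
  (1491 , 162) ∷ (146 , 1000) ∷ (4145 , 1801) ∷ (2645 , 706) ∷ (2105 , 2041) ∷ (1046 , 1657) ∷ (386 , 805) ∷ (773 , 3460) ∷
  (1604 , 1822) ∷ (2249 , 1924) ∷ (752 , 3517) ∷ (357 , 552) ∷ (3414 , 1755) ∷ (3477 , 2361) ∷ (2808 , 2925) ∷ (2913 , 1053) ∷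
  (93 , 3508) ∷ (1071 , 283) ∷ (1596 , 3445) ∷ (1785 , 952) ∷ (4101 , 3340) ∷ (395 , 2318) ∷ (1295 , 431) ∷ (1619 , 3383) ∷
  (3119 , 1679) ∷ (3659 , 2276) ∷ (278 , 3238) ∷ (3155 , 1915) ∷ (1424 , 2995) ∷ (455 , 790) ∷ (452 , 2590) ∷ (97 , 2327) ∷
  (1303 , 953) ∷ (2083 , 3398) ∷ (4093 , 2549) ∷ (3952 , 860) ∷ (2 , 36) ∷ (116 , 2088) ∷ (2405 , 60) ∷ (1154 , 3480) ∷
  (2087 , 2982) ∷ (327 , 837) ∷ (1674 , 993) ∷ (1986 , 1395) ∷ (2790 , 3096) ∷ (1869 , 2325) ∷ (161 , 2001) ∷ (692 , 3660) ∷
  (1229 , 453) ∷ (2114 , 336) ∷ (1568 , 2196) ∷ (409 , 2280) ∷ (2107 , 2550) ∷ (1162 , 918) ∷ (2551 , 1368) ∷ (976 , 1530) ∷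
  (183 , 1084) ∷ (1968 , 2350) ∷ (1746 , 2287) ∷ (1839 , 2956) ∷ (2910 , 2851) ∷ (273 , 394) ∷ (2865 , 1237) ∷ (1896 , 2578) ∷
  (1893 , 2542) ∷ (1719 , 454) ∷ (229 , 1207) ∷ (313 , 838) ∷ (862 , 1051) ∷ (2443 , 436) ∷ (3358 , 3673) ∷ (246 , 1559) ∷
  (1299 , 3962) ∷ (1851 , 677) ∷ (3606 , 359) ∷ (1644 , 3530) ∷ (142 , 2733) ∷ (3913 , 2886) ∷ (2158 , 3114) ∷ (4120 , 3369) ∷
  (1195 , 867) ∷ (282 , 2513) ∷ (3387 , 3095) ∷ (1911 , 2267) ∷ (2763 , 1796) ∷ (303 , 416) ∷ (99 , 2497) ∷ (1419 , 2167) ∷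
  (165 , 319) ∷ (924 , 1210) ∷ (1716 , 1012) ∷ (72 , 2774) ∷ (4176 , 941) ∷ (120 , 2702) ∷ (2637 , 1088) ∷ (1641 , 2582) ∷
  (37 , 2857) ∷ (2146 , 1432) ∷ (3424 , 919) ∷ (4057 , 1426) ∷ (1864 , 571) ∷ (204 , 211) ∷ (3186 , 3592) ∷ (3222 , 832) ∷
  (987 , 703) ∷ (1047 , 1867) ∷ (81 , 1305) ∷ (375 , 2199) ∷ (135 , 2175) ∷ (3507 , 783) ∷ (225 , 2184) ∷ (260 , 3700) ∷
  (2111 , 2773) ∷ (1394 , 883) ∷ (3038 , 3661) ∷ (3284 , 511) ∷ (67 , 908) ∷ (3886 , 788) ∷ (592 , 2474) ∷ (4075 , 833) ∷
  (2908 , 761) ∷ (141 , 3308) ∷ (3855 , 1652) ∷ (3117 , 710) ∷ (3543 , 2273) ∷ (2313 , 2144) ∷ (209 , 2401) ∷ (3476 , 922) ∷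
  (2750 , 1600) ∷ (3872 , 2017) ∷ (4103 , 265) ∷ (153 , 600) ∷ (228 , 216) ∷ (255 , 3882) ∷ (1821 , 360) ∷ (1866 , 3588) ∷
  (92 , 3505) ∷ (1013 , 109) ∷ (2555 , 1999) ∷ (1208 , 3544) ∷ (896 , 2371) ∷ (393 , 2708) ∷ (1179 , 1436) ∷ (3537 , 1151) ∷
  (1965 , 1913) ∷ (1572 , 2879) ∷ (305 , 3642) ∷ (398 , 3732) ∷ (1469 , 306) ∷ (3065 , 456) ∷ (527 , 510) ∷ (551 , 1676) ∷
  (1697 , 2102) ∷ (3320 , 872) ∷ (2348 , 3023) ∷ (2171 , 2414) ∷ (87 , 1225) ∷ (723 , 1882) ∷ (3027 , 1081) ∷ (2646 , 2176) ∷
  (2163 , 841) ∷ (139 , 301) ∷ (3739 , 166) ∷ (712 , 982) ∷ (2389 , 757) ∷ (226 , 676) ∷ (94 , 471) ∷ (1129 , 1380) ∷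
  (637 , 2226) ∷ (2362 , 3741) ∷ (2983 , 828) ∷ (96 , 2986) ∷ (1245 , 268) ∷ (3042 , 2575) ∷ (3516 , 2368) ∷ (747 , 3331) ∷
  (51 , 3604) ∷ (2958 , 1528) ∷ (2967 , 2164) ∷ (3489 , 145) ∷ (3504 , 4087) ∷ (44 , 231) ∷ (2552 , 429) ∷ (1034 , 3267) ∷
  (3773 , 3597) ∷ (2684 , 1122) ∷ (413 , 810) ∷ (2339 , 3750) ∷ (1649 , 1350) ∷ (536 , 486) ∷ (827 , 2250) ∷ (574 , 1688) ∷
  (3031 , 2798) ∷ (2878 , 2333) ∷ (2650 , 1301) ∷ (2395 , 1967) ∷ (353 , 2785) ∷ (3182 , 1579) ∷ (2990 , 799) ∷ (500 , 3112) ∷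
  (3062 , 3253) ∷ (558 , 1577) ∷ (2103 , 683) ∷ (930 , 707) ∷ (2064 , 2099) ∷ (2991 , 698) ∷ (22 , 498) ∷ (1276 , 2946) ∷
  (517 , 2271) ∷ (4048 , 2028) ∷ (1342 , 903) ∷ (110 , 2781) ∷ (2057 , 1347) ∷ (2585 , 312) ∷ (2948 , 804) ∷ (2387 , 3402) ∷
  (101 , 2700) ∷ (1535 , 972) ∷ (2570 , 177) ∷ (2078 , 1620) ∷ (3803 , 3177) ∷ (73 , 693) ∷ (4234 , 1287) ∷ (3484 , 1155) ∷
  (3214 , 2145) ∷ (523 , 3366) ∷ (59 , 2600) ∷ (3422 , 3818) ∷ (3941 , 971) ∷ (3782 , 119) ∷ (3206 , 2579) ∷ (421 , 1283) ∷
  (2803 , 923) ∷ (2623 , 1658) ∷ (829 , 1058) ∷ (529 , 842) ∷ (31 , 1140) ∷ (1798 , 1275) ∷ (532 , 459) ∷ (595 , 684) ∷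
  (4249 , 765) ∷ (625 , 1815) ∷ (1666 , 1518) ∷ (1522 , 1584) ∷ (1816 , 1089) ∷ (1576 , 2640) ∷ (355 , 657) ∷ (3298 , 3522) ∷
  (1072 , 1095) ∷ (1654 , 2988) ∷ (826 , 384) ∷ (114 , 2080) ∷ (2289 , 3919) ∷ (3072 , 2506) ∷ (933 , 2689) ∷ (2238 , 334) ∷
  (261 , 1919) ∷ (2169 , 3227) ∷ (435 , 1277) ∷ (3615 , 575) ∷ (2166 , 3089) ∷ (253 , 2541) ∷ (1705 , 396) ∷ (3784 , 1353) ∷
  (3322 , 660) ∷ (2464 , 3696) ∷ (9 , 581) ∷ (522 , 3437) ∷ (15 , 488) ∷ (870 , 2366) ∷ (2907 , 3215) ∷ (399 , 2054) ∷
  (1527 , 2411) ∷ (2106 , 1502) ∷ (1104 , 656) ∷ (3510 , 3464) ∷ (27 , 845) ∷ (1566 , 1457) ∷ (45 , 2369) ∷ (2610 , 3389) ∷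
  (75 , 2027) ∷ (199 , 2049) ∷ (2896 , 2121) ∷ (3694 , 1974) ∷ (2425 , 2094) ∷ (2314 , 408) ∷ (98 , 973) ∷ (1361 , 235) ∷
  (1124 , 661) ∷ (347 , 3754) ∷ (2834 , 1582) ∷ (182 , 3213) ∷ (1910 , 465) ∷ (2705 , 1032) ∷ (1262 , 3657) ∷ (4028 , 279) ∷
  (100 , 1316) ∷ (1477 , 2837) ∷ (3529 , 272) ∷ (1501 , 2807) ∷ (598 , 2855) ∷ (77 , 2602) ∷ (143 , 3934) ∷ (3971 , 3376) ∷
  (1199 , 1273) ∷ (374 , 343) ∷ (213 , 3170) ∷ (3708 , 2294) ∷ (3237 , 3362) ∷ (1857 , 461) ∷ (3954 , 800) ∷ (25 , 1233) ∷
  (1450 , 2346) ∷ (1963 , 2055) ∷ (1456 , 2469) ∷ (2311 , 543) ∷ (130 , 2518) ∷ (3217 , 3385) ∷ (697 , 1795) ∷ (1519 , 358) ∷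
  (1642 , 3472) ∷ (423 , 2632) ∷ (2919 , 1351) ∷ (705 , 544) ∷ (1983 , 1291) ∷ (2616 , 1387) ∷ (186 , 2713) ∷ (2142 , 1726) ∷
  (3192 , 679) ∷ (3570 , 475) ∷ (3879 , 1612) ∷ (458 , 1653) ∷ (626 , 768) ∷ (1724 , 1314) ∷ (563 , 2721) ∷ (2393 , 2190) ∷
  (123 , 610) ∷ (2811 , 796) ∷ (3087 , 2938) ∷ (1803 , 1807) ∷ (822 , 1054) ∷ (24 , 2231) ∷ (1392 , 4031) ∷ (2922 , 356) ∷
  (879 , 3356) ∷ (3429 , 113) ∷ (354 , 1751) ∷ (3240 , 2129) ∷ (2031 , 2438) ∷ (1077 , 3068) ∷ (1944 , 701) ∷ (46 , 2875) ∷
  (2668 , 2476) ∷ (3439 , 949) ∷ (604 , 3166) ∷ (448 , 2062) ∷ (66 , 402) ∷ (3828 , 1701) ∷ (1551 , 3552) ∷ (3498 , 2835) ∷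
  (4026 , 156) ∷ (83 , 835) ∷ (491 , 877) ∷ (2540 , 3313) ∷ (338 , 1942) ∷ (2312 , 238) ∷ (56 , 3432) ∷ (3248 , 198) ∷
  (2495 , 2838) ∷ (2051 , 330) ∷ (2237 , 1848) ∷ (871 , 1905) ∷ (2965 , 2415) ∷ (3373 , 1734) ∷ (1099 , 1143) ∷ (3220 , 1449) ∷
  (112 , 192) ∷ (2173 , 2490) ∷ (667 , 1761) ∷ (4102 , 2709) ∷ (151 , 1494) ∷ (287 , 2396) ∷ (3677 , 632) ∷ (1439 , 2072) ∷
  (1325 , 3455) ∷ (3359 , 1532) ∷ (481 , 2770) ∷ (1960 , 709) ∷ (1282 , 2215) ∷ (865 , 3103) ∷ (2617 , 2731) ∷ (136 , 345) ∷
  (3565 , 2718) ∷ (3589 , 2016) ∷ (658 , 207) ∷ (3580 , 3360) ∷ (12 , 2717) ∷ (696 , 1958) ∷ (1461 , 1166) ∷ (2601 , 2783) ∷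
  (3876 , 1463) ∷ (206 , 856) ∷ (3302 , 2095) ∷ (1304 , 466) ∷ (2141 , 1090) ∷ (3134 , 2698) ∷ (407 , 1622) ∷ (1991 , 3293) ∷
  (3080 , 782) ∷ (1397 , 2126) ∷ (3212 , 2264) ∷ (138 , 1497) ∷ (3681 , 366) ∷ (1671 , 3936) ∷ (1812 , 3492) ∷ (1344 , 3678) ∷
  (243 , 1370) ∷ (1125 , 1646) ∷ (405 , 362) ∷ (1875 , 3704) ∷ (675 , 3005) ∷ (208 , 501) ∷ (3418 , 3120) ∷ (3709 , 3717) ∷
  (3295 , 3759) ∷ (898 , 1872) ∷ (125 , 127) ∷ (2927 , 3043) ∷ (1169 , 3574) ∷ (2957 , 4111) ∷ (2909 , 673) ∷ (234 , 2594) ∷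
  (603 , 3470) ∷ (390 , 2402) ∷ (1005 , 980) ∷ (2091 , 641) ∷ (84 , 3059) ∷ (549 , 179) ∷ (1581 , 1736) ∷ (915 , 1259) ∷
  (1194 , 3854) ∷ (14 , 1797) ∷ (812 , 474) ∷ (3866 , 1554) ∷ (3755 , 3672) ∷ (1640 , 1149) ∷ (364 , 2766) ∷ (3820 , 477) ∷
  (1087 , 1728) ∷ (2524 , 795) ∷ (3733 , 2880) ∷ (422 , 3810) ∷ (2861 , 507) ∷ (1664 , 3468) ∷ (1406 , 2286) ∷ (3734 , 2898) ∷
  (21 , 49) ∷ (1218 , 2842) ∷ (1476 , 562) ∷ (3471 , 2335) ∷ (2460 , 1417) ∷ (57 , 3986) ∷ (3306 , 2069) ∷ (1536 , 3281) ∷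
  (2628 , 86) ∷ (1119 , 665) ∷ (159 , 2765) ∷ (576 , 419) ∷ (3147 , 2687) ∷ (960 , 218) ∷ (3804 , 3998) ∷ (351 , 1147) ∷
  (3066 , 1681) ∷ (585 , 2392) ∷ (3669 , 400) ∷ (975 , 1585) ∷ (53 , 219) ∷ (3074 , 4056) ∷ (1049 , 1806) ∷ (320 , 996) ∷
  (1268 , 1569) ∷ (117 , 4027) ∷ (2463 , 124) ∷ (195 , 2869) ∷ (2664 , 2128) ∷ (3207 , 2380) ∷ (20 , 528) ∷ (1160 , 363) ∷
  (2435 , 3762) ∷ (2894 , 2046) ∷ (3578 , 1947) ∷ (102 , 2870) ∷ (1593 , 2186) ∷ (1611 , 1421) ∷ (2655 , 281) ∷ (2685 , 3329) ∷
  (128 , 836) ∷ (3101 , 935) ∷ (2615 , 2354) ∷ (365 , 2519) ∷ (3878 , 3443) ∷ (462 , 3245) ∷ (858 , 2321) ∷ (2211 , 605) ∷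
  (2871 , 506) ∷ (2244 , 3410) ∷ (42 , 955) ∷ (2436 , 3514) ∷ (2952 , 631) ∷ (2619 , 2014) ∷ (597 , 91) ∷ (1 , 4001) ∷
  (58 , 2939) ∷ (3364 , 1865) ∷ (577 , 95) ∷ (3205 , 1187) ∷ (13 , 3624) ∷ (754 , 2688) ∷ (502 , 276) ∷ (3178 , 3039) ∷
  (2758 , 3342) ∷ (69 , 2168) ∷ (4002 , 377) ∷ (2997 , 251) ∷ (906 , 1589) ∷ (672 , 1379) ∷ (252 , 2710) ∷ (1647 , 1552) ∷
  (420 , 3556) ∷ (2745 , 3067) ∷ (3582 , 643) ∷ (172 , 1062) ∷ (1330 , 1074) ∷ (3649 , 1770) ∷ (4138 , 3231) ∷ (2239 , 1509) ∷
  (687 , 2812) ∷ (939 , 3145) ∷ (2586 , 844) ∷ (3006 , 1399) ∷ (1428 , 3328) ∷ (29 , 714) ∷ (1682 , 2505) ∷ (2450 , 2631) ∷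
  (3764 , 1293) ∷ (2162 , 1503) ∷ (309 , 2170) ∷ (630 , 493) ∷ (1956 , 2656) ∷ (1050 , 2743) ∷ (378 , 3466) ∷ (137 , 1008) ∷
  (3623 , 2265) ∷ (2630 , 1680) ∷ (1235 , 2334) ∷ (2462 , 1359) ∷ (241 , 1929) ∷ (1009 , 3807) ∷ (2323 , 333) ∷ (721 , 2022) ∷
  (2911 , 555) ∷ (349 , 3218) ∷ (2950 , 755) ∷ (2503 , 560) ∷ (2515 , 2219) ∷ (3211 , 3335) ∷ (33 , 1523) ∷ (1914 , 1874) ∷
  (2937 , 617) ∷ (1749 , 1202) ∷ (2013 , 548) ∷ (34 , 926) ∷ (1972 , 1832) ∷ (1978 , 2504) ∷ (2326 , 2573) ∷ (895 , 2252) ∷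
  (169 , 3553) ∷ (1156 , 2893) ∷ (2203 , 3520) ∷ (2407 , 979) ∷ (1270 , 583) ∷ (104 , 1132) ∷ (1709 , 811) ∷ (4016 , 3808) ∷
  (3809 , 391) ∷ (449 , 1063) ∷ (197 , 1886) ∷ (2780 , 1313) ∷ (1289 , 2663) ∷ (1271 , 3149) ∷ (227 , 1076) ∷ (490 , 927) ∷
  (2482 , 1890) ∷ (1297 , 1545) ∷ (1735 , 3150) ∷ (1201 , 1134) ∷ (82 , 3375) ∷ (433 , 1215) ∷ (3499 , 1302) ∷ (4084 , 2025) ∷
  (3430 , 729) ∷ (310 , 1065) ∷ (688 , 1248) ∷ (997 , 3216) ∷ (1627 , 639) ∷ (3583 , 2478) ∷ (152 , 193) ∷ (170 , 2548) ∷
  (1214 , 802) ∷ (1244 , 3286) ∷ (2984 , 376) ∷ (103 , 2916) ∷ (1651 , 531) ∷ (652 , 537) ∷ (3232 , 885) ∷ (1567 , 3777) ∷ []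

proposition5p5 : APS 651 (651 / 3) (651 / 3) × APS 2343 (2343 / 3) (2343 / 3) × APS 4323 (4323 / 3) (4323 / 3)
proposition5p5 =
  aps-fromCertificate 651 (651 / 3) (651 / 3) S651 refl refl refl ,
  aps-fromCertificate 2343 (2343 / 3) (2343 / 3) S2343 refl refl refl ,
  aps-fromCertificate 4323 (4323 / 3) (4323 / 3) S4323 refl refl refl
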